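{- For every real $t$, as formal power series in $x$, $$\Phi_0(2t,x)=\Phi_0(t,x)\Lambda_0(t,x),\qquad \Lambda_0(2t,x)=\Lambda_0(t,x)^2-2.$$
   Context: All series are formal power series in an indeterminate $x$ with real coefficients. For real $s$ and integer $m\ge 0$, $\binom{s}{m}=s(s-1)\cdots(s-m+1)/m!$. For real $s$ define $\Phi_0(s,x)=\sum_{k\ge1}\binom{s/2+k-1}{2k-1}x^{2k-1}$ and $\Lambda_0(s,x)=\sum_{k\ge0}\binom{s/2+k}{2k}\frac{s}{s/2+k}x^{2k}$, where each coefficient of $\Lambda_0$ is understood as the polynomial in $s$ it defines (the constant term is $2$, and for $k\ge1$ the coefficient of $x^{2k}$ is $\frac{s}{2k}\binom{s/2+k-1}{2k-1}$). -}

module Defs where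

open import Level using (Level; _⊔_; suc)
open import Algebra.Bundles using (CommutativeRing)
open import Data.Nat as ℕ using (ℕ; zero) renaming (suc to sucℕ)
open import Data.Nat.Base using () renaming (_! to _!ℕ)
open import Data.Product using (Σ; _×_; _,_)
open import Data.Sum using (_⊎_; inj₁; inj₂)
open import Relation.Nullary using (¬_)

-- Inverse is a total operation, specified only on nonzero elements.
record RealField (c ℓ : Level) : Set (suc (c ⊔ ℓ)) where
  field
    commRing : CommutativeRing c ℓ
  open CommutativeRing commRing public
  field
    0≉1       : ¬ (0# ≈ 1#)
    _⁻¹       : Carrier → Carrier
    ⁻¹-cong   : ∀ {x y} → x ≈ y → x ⁻¹ ≈ y ⁻¹
    inverseʳ  : ∀ x → ¬ (x ≈ 0#) → x * (x ⁻¹) ≈ 1#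
    _≤_       : Carrier → Carrier → Set ℓ
    ≤-resp-≈  : ∀ {x x' y y'} → x ≈ x' → y ≈ y' → x ≤ y → x' ≤ y'
    ≤-refl    : ∀ {x} → x ≤ x
    ≤-trans   : ∀ {x y z} → x ≤ y → y ≤ z → x ≤ z
    ≤-antisym : ∀ {x y} → x ≤ y → y ≤ x → x ≈ y
    ≤-total   : ∀ x y → (x ≤ y) ⊎ (y ≤ x)
    +-mono-≤  : ∀ {x y} z → x ≤ y → (x + z) ≤ (y + z)
    *-nonneg  : ∀ {x y} → 0# ≤ x → 0# ≤ y → 0# ≤ (x * y)
    lub       : (P : Carrier → Set c) → Σ Carrier P →
                Σ Carrier (λ b → ∀ x → P x → x ≤ b) →
                Σ Carrier (λ s → (∀ x → P x → x ≤ s) ×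
                                 (∀ b → (∀ x → P x → x ≤ b) → s ≤ b))

module Series {c ℓ : Level} (R : RealField c ℓ) where
  open RealField R hiding (zero)

  fromℕ : ℕ → Carrier
  fromℕ zero = 0#
  fromℕ (sucℕ n) = 1# + fromℕ n

  two : Carrier
  two = 1# + 1#

  sumBelow : ℕ → (ℕ → Carrier) → Carrier
  sumBelow zero f = 0#
  sumBelow (sucℕ n) f = sumBelow n f + f n

  prodBelow : ℕ → (ℕ → Carrier) → Carrier
  prodBelow zero f = 1#
  prodBelow (sucℕ n) f = prodBelow n f * f n

  binom : Carrier → ℕ → Carrier
  binom s m = prodBelow m (λ i → s - fromℕ i) * (fromℕ (m !ℕ)) ⁻¹

  PowerSeries : Set c
  PowerSeries = ℕ → Carrier

  _≋_ : PowerSeries → PowerSeries → Set ℓ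
  f ≋ g = ∀ n → f n ≈ g n

  _⊛_ : PowerSeries → PowerSeries → PowerSeries
  (f ⊛ g) n = sumBelow (sucℕ n) (λ i → f i * g (n ℕ.∸ i))

  _⊖_ : PowerSeries → PowerSeries → PowerSeries
  (f ⊖ g) n = f n - g n

  const : Carrier → PowerSeries
  const a zero = a
  const a (sucℕ n) = 0#

  -- parity n = inj₁ j if n = 2j, inj₂ j if n = 2j+1
  parity : ℕ → ℕ ⊎ ℕ
  parity zero = inj₁ zero
  parity (sucℕ n) with parity n
  ... | inj₁ j = inj₂ j
  ... | inj₂ j = inj₁ (sucℕ j)

  half : Carrier → Carrier
  half s = s * two ⁻¹

  -- Φ₀(s,x) = Σ_{k≥1} binom(s/2+k-1, 2k-1) x^{2k-1}; with k = j+1 the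
  -- coefficient of x^{2j+1} is binom(s/2+j, 2j+1); even coefficients vanish.
  Φ₀ : Carrier → PowerSeries
  Φ₀ s n with parity n
  ... | inj₁ j = 0#
  ... | inj₂ j = binom (half s + fromℕ j) (2 ℕ.* j ℕ.+ 1)

  -- Λ₀(s,x): constant term 2, coefficient of x^{2k} (k ≥ 1) is
  -- (s/(2k)) binom(s/2+k-1, 2k-1); odd coefficients vanish.
  Λ₀ : Carrier → PowerSeries
  Λ₀ s n with parity n
  ... | inj₂ j = 0#
  ... | inj₁ zero = two
  ... | inj₁ (sucℕ j) =
        (s * (fromℕ (2 ℕ.* sucℕ j)) ⁻¹) * binom (half s + fromℕ j) (2 ℕ.* j ℕ.+ 1)

-- Write x = 2 sinh y.  Then Λ₀(s, x) = 2 cosh (s y) and Φ₀(s, x) = 2 sinh (s y) / √(4 + x²),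
-- so the theorem is cosh 2z = 2 cosh² z − 1 and sinh 2z = 2 sinh z cosh z in disguise.
-- Formally, with θ = x d/dx, the pair A = Λ₀(s), B = Φ₀(s) is the unique solution of
--   θA = s x B,   (4 + x²) θB + x² B = s x A,   A(0) = 2,  B(0) = 0,
-- since these equations determine the coefficients recursively; that Λ₀(s), Φ₀(s) satisfy them
-- comes from the ratio of consecutive binomial coefficients.  For s = 2t the pair
-- (Λ₀(t)² − 2, Φ₀(t) Λ₀(t)) is another solution, by the Leibniz rule for θ and the identity
-- (4 + x²) Φ₀(t)² = Λ₀(t)² − 4, whose two sides have the same θ-image and constant term.
module Submission where

open import Defs
open import Level using (Level)
open import Algebra.Bundles using (CommutativeRing)
import Algebra.Solver.Ring
import Algebra.Solver.Ring.AlmostCommutativeRing as ACR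
open import Data.Integer as ℤ using (ℤ; +_; -[1+_])
import Data.Integer.Properties as ℤ
open import Data.Maybe using (Maybe; just; nothing)
open import Data.Nat as ℕ using (ℕ; zero; suc)
import Data.Nat.Properties as ℕ
open import Data.Product using (_×_; _,_; proj₁; proj₂; swap)
open import Data.Sign as Sign using (Sign)
open import Data.Sum using (inj₁; inj₂)
open import Function using (_∘_)
open import Relation.Binary.Bundles using (Setoid)
open import Relation.Binary.PropositionalEquality as ≡ using (_≡_)
import Relation.Binary.Reasoning.Setoid
open import Relation.Nullary using (¬_; yes; no)

module IntegerCoefficients {c ℓ} (CR : CommutativeRing c ℓ) where
  open CommutativeRing CR
  open import Algebra.Properties.Ring ring using (-1*x≈-x; -‿involutive; -0#≈0#; -‿+-comm)
  open import Algebra.Properties.CommutativeSemigroup +-commutativeSemigroup using (interchange; x∙yz≈y∙xz)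
  open import Algebra.Properties.CommutativeSemigroup *-commutativeSemigroup
    using () renaming (interchange to *-interchange)
  open import Algebra.Properties.Semiring.Mult.TCOptimised semiring
    using (1+×; ×-homo-+; ×1-homo-*) renaming (_×_ to _×′_)
  open Relation.Binary.Reasoning.Setoid setoid

  -- The optimised multiple _×′_ makes ⟦ + 2 ⟧ reduce to 1# + 1#, the numeral `two` of Defs.
  ⟦_⟧ : ℤ → Carrier
  ⟦ + n ⟧ = n ×′ 1#
  ⟦ -[1+ n ] ⟧ = - (suc n ×′ 1#)

  ⟦⊖⟧ : ∀ m n → ⟦ m ℤ.⊖ n ⟧ ≈ m ×′ 1# - n ×′ 1#
  ⟦⊖⟧ zero zero = sym (-‿inverseʳ 0#)
  ⟦⊖⟧ (suc m) zero = sym (trans (+-congˡ -0#≈0#) (+-identityʳ _))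
  ⟦⊖⟧ zero (suc n) = sym (+-identityˡ _)
  ⟦⊖⟧ (suc m) (suc n) = begin
    ⟦ suc m ℤ.⊖ suc n ⟧        ≡⟨ ≡.cong ⟦_⟧ (ℤ.[1+m]⊖[1+n]≡m⊖n m n) ⟩
    ⟦ m ℤ.⊖ n ⟧                ≈⟨ ⟦⊖⟧ m n ⟩
    M - N                      ≈⟨ +-identityˡ _ ⟨
    0# + (M - N)               ≈⟨ +-congʳ (-‿inverseʳ 1#) ⟨
    (1# - 1#) + (M - N)        ≈⟨ interchange _ _ _ _ ⟩
    (1# + M) + (- 1# - N)      ≈⟨ +-congˡ (-‿+-comm 1# N) ⟩
    (1# + M) - (1# + N)        ≈⟨ +-cong (1+× m 1#) (-‿cong (1+× n 1#)) ⟨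
    suc m ×′ 1# - suc n ×′ 1#  ∎
    where
    M N : Carrier
    M = m ×′ 1#
    N = n ×′ 1#

  ⟦-⟧ : ∀ i → ⟦ ℤ.- i ⟧ ≈ - ⟦ i ⟧
  ⟦-⟧ -[1+ n ] = sym (-‿involutive _)
  ⟦-⟧ (+ zero) = sym -0#≈0#
  ⟦-⟧ (+ suc n) = refl

  ⟦+⟧ : ∀ i j → ⟦ i ℤ.+ j ⟧ ≈ ⟦ i ⟧ + ⟦ j ⟧
  ⟦+⟧ (+ m) (+ n) = ×-homo-+ 1# m n
  ⟦+⟧ (+ m) -[1+ n ] = ⟦⊖⟧ m (suc n)
  ⟦+⟧ -[1+ m ] (+ n) = trans (⟦⊖⟧ n (suc m)) (+-comm _ _)
  ⟦+⟧ -[1+ m ] -[1+ n ] = trans (-‿cong (begin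
    suc (suc m ℕ.+ n) ×′ 1#            ≈⟨ 1+× (suc m ℕ.+ n) 1# ⟩
    1# + (suc m ℕ.+ n) ×′ 1#           ≈⟨ +-congˡ (×-homo-+ 1# (suc m) n) ⟩
    1# + (suc m ×′ 1# + n ×′ 1#)       ≈⟨ x∙yz≈y∙xz _ _ _ ⟩
    suc m ×′ 1# + (1# + n ×′ 1#)       ≈⟨ +-congˡ (1+× n 1#) ⟨
    suc m ×′ 1# + suc n ×′ 1#          ∎)) (sym (-‿+-comm _ _))

  signed : Sign → Carrier
  signed Sign.+ = 1#
  signed Sign.- = - 1#

  signed-* : ∀ s t → signed (s Sign.* t) ≈ signed s * signed t
  signed-* Sign.- Sign.- = sym (trans (-1*x≈-x _) (-‿involutive _))
  signed-* Sign.- Sign.+ = sym (*-identityʳ _)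
  signed-* Sign.+ t = sym (*-identityˡ _)

  ⟦◃⟧ : ∀ s n → ⟦ s ℤ.◃ n ⟧ ≈ signed s * n ×′ 1#
  ⟦◃⟧ s zero = sym (zeroʳ _)
  ⟦◃⟧ Sign.+ (suc n) = sym (*-identityˡ _)
  ⟦◃⟧ Sign.- (suc n) = sym (-1*x≈-x _)

  ⟦*⟧ : ∀ i j → ⟦ i ℤ.* j ⟧ ≈ ⟦ i ⟧ * ⟦ j ⟧
  ⟦*⟧ i j = begin
    ⟦ (σᵢ Sign.* σⱼ) ℤ.◃ (∣i∣ ℕ.* ∣j∣) ⟧                  ≈⟨ ⟦◃⟧ (σᵢ Sign.* σⱼ) (∣i∣ ℕ.* ∣j∣) ⟩
    signed (σᵢ Sign.* σⱼ) * (∣i∣ ℕ.* ∣j∣) ×′ 1#          ≈⟨ *-cong (signed-* σᵢ σⱼ) (×1-homo-* ∣i∣ ∣j∣) ⟩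
    (signed σᵢ * signed σⱼ) * (∣i∣ ×′ 1# * ∣j∣ ×′ 1#)    ≈⟨ *-interchange _ _ _ _ ⟩
    (signed σᵢ * ∣i∣ ×′ 1#) * (signed σⱼ * ∣j∣ ×′ 1#)    ≈⟨ *-cong (⟦sign◃∣∣⟧ i) (⟦sign◃∣∣⟧ j) ⟩
    ⟦ i ⟧ * ⟦ j ⟧                                          ∎
    where
    σᵢ σⱼ : Sign
    σᵢ = ℤ.sign i
    σⱼ = ℤ.sign j
    ∣i∣ ∣j∣ : ℕ
    ∣i∣ = ℤ.∣ i ∣
    ∣j∣ = ℤ.∣ j ∣
    ⟦sign◃∣∣⟧ : ∀ k → signed (ℤ.sign k) * ℤ.∣ k ∣ ×′ 1# ≈ ⟦ k ⟧
    ⟦sign◃∣∣⟧ k = trans (sym (⟦◃⟧ (ℤ.sign k) ℤ.∣ k ∣)) (reflexive (≡.cong ⟦_⟧ (ℤ.◃-inverse k)))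

  homomorphism : ℤ.+-*-rawRing ACR.-Raw-AlmostCommutative⟶ ACR.fromCommutativeRing CR
  homomorphism = record
    { ⟦_⟧ = ⟦_⟧ ; +-homo = ⟦+⟧ ; *-homo = ⟦*⟧ ; -‿homo = ⟦-⟧ ; 0-homo = refl ; 1-homo = refl }

  ⟦_⟧≟⟦_⟧ : ∀ i j → Maybe (⟦ i ⟧ ≈ ⟦ j ⟧)
  ⟦ i ⟧≟⟦ j ⟧ with i ℤ.≟ j
  ... | yes ≡.refl = just refl
  ... | no _ = nothing

  open Algebra.Solver.Ring ℤ.+-*-rawRing (ACR.fromCommutativeRing CR) homomorphism ⟦_⟧≟⟦_⟧ public
    using (Polynomial; solve; _:=_; _:+_; _:*_; _:-_; con)

  infix 10 #_
  #_ : ∀ {m} → ℕ → Polynomial m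
  # k = con (+ k)

module RealFieldProperties {c ℓ} (R : RealField c ℓ) where
  open RealField R
  open Series R using (fromℕ; two)
  open IntegerCoefficients commRing using (solve; _:=_; _:+_; _:*_; #_)
  open Relation.Binary.Reasoning.Setoid setoid
  open import Algebra.Properties.CommutativeSemigroup *-commutativeSemigroup using (x∙yz≈y∙xz)

  fromℕ-+ : ∀ m n → fromℕ (m ℕ.+ n) ≈ fromℕ m + fromℕ n
  fromℕ-+ zero n = sym (+-identityˡ _)
  fromℕ-+ (suc m) n = trans (+-congˡ (fromℕ-+ m n)) (sym (+-assoc _ _ _))

  fromℕ-* : ∀ m n → fromℕ (m ℕ.* n) ≈ fromℕ m * fromℕ n
  fromℕ-* zero n = sym (zeroˡ _)
  fromℕ-* (suc m) n = begin
    fromℕ (n ℕ.+ m ℕ.* n)             ≈⟨ fromℕ-+ n (m ℕ.* n) ⟩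
    fromℕ n + fromℕ (m ℕ.* n)         ≈⟨ +-cong (sym (*-identityˡ _)) (fromℕ-* m n) ⟩
    1# * fromℕ n + fromℕ m * fromℕ n  ≈⟨ distribʳ _ _ _ ⟨
    (1# + fromℕ m) * fromℕ n          ∎

  0≤1 : 0# ≤ 1#
  0≤1 with ≤-total 0# 1#
  ... | inj₁ 0≤1 = 0≤1
  ... | inj₂ 1≤0 = ≤-resp-≈ refl -1*-1≈1 (*-nonneg 0≤-1 0≤-1)
    where
    open import Algebra.Properties.Ring ring using (-1*x≈-x; -‿involutive)
    0≤-1 : 0# ≤ (- 1#)
    0≤-1 = ≤-resp-≈ (-‿inverseʳ 1#) (+-identityˡ _) (+-mono-≤ (- 1#) 1≤0)
    -1*-1≈1 : - 1# * - 1# ≈ 1#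
    -1*-1≈1 = trans (-1*x≈-x (- 1#)) (-‿involutive 1#)

  0≤fromℕ : ∀ n → 0# ≤ fromℕ n
  1≤fromℕ-suc : ∀ n → 1# ≤ fromℕ (suc n)

  0≤fromℕ zero = ≤-refl
  0≤fromℕ (suc n) = ≤-trans 0≤1 (1≤fromℕ-suc n)

  1≤fromℕ-suc n = ≤-resp-≈ (+-identityˡ 1#) (+-comm _ _) (+-mono-≤ 1# (0≤fromℕ n))

  fromℕ≉0 : ∀ n .{{_ : ℕ.NonZero n}} → ¬ (fromℕ n ≈ 0#)
  fromℕ≉0 (suc n) 1+n≈0 = 0≉1 (≤-antisym 0≤1 (≤-resp-≈ refl 1+n≈0 (1≤fromℕ-suc n)))

  x*[y*x⁻¹]≈y : ∀ {x} y → ¬ (x ≈ 0#) → x * (y * x ⁻¹) ≈ y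
  x*[y*x⁻¹]≈y {x} y x≉0 = begin
    x * (y * x ⁻¹)   ≈⟨ x∙yz≈y∙xz x y (x ⁻¹) ⟩
    y * (x * x ⁻¹)   ≈⟨ *-congˡ (inverseʳ x x≉0) ⟩
    y * 1#           ≈⟨ *-identityʳ y ⟩
    y                ∎

  *-cancelˡ : ∀ {a x y} → ¬ (a ≈ 0#) → a * x ≈ a * y → x ≈ y
  *-cancelˡ {a} {x} {y} a≉0 ax≈ay = begin
    x                   ≈⟨ x*[y*x⁻¹]≈y x a≉0 ⟨
    a * (x * a ⁻¹)      ≈⟨ *-assoc _ _ _ ⟨
    (a * x) * a ⁻¹      ≈⟨ *-congʳ ax≈ay ⟩
    (a * y) * a ⁻¹      ≈⟨ *-assoc _ _ _ ⟩
    a * (y * a ⁻¹)      ≈⟨ x*[y*x⁻¹]≈y y a≉0 ⟩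
    y                   ∎

  fromℕ-cancelˡ : ∀ n {x y} .{{_ : ℕ.NonZero n}} → fromℕ n * x ≈ fromℕ n * y → x ≈ y
  fromℕ-cancelˡ n = *-cancelˡ (fromℕ≉0 n)

  x*[x*y]⁻¹≈y⁻¹ : ∀ {x y} → ¬ (y ≈ 0#) → ¬ (x * y ≈ 0#) → x * (x * y) ⁻¹ ≈ y ⁻¹
  x*[x*y]⁻¹≈y⁻¹ {x} {y} y≉0 xy≉0 = *-cancelˡ y≉0 (begin
    y * (x * (x * y) ⁻¹)   ≈⟨ *-assoc _ _ _ ⟨
    (y * x) * (x * y) ⁻¹   ≈⟨ *-congʳ (*-comm y x) ⟩
    (x * y) * (x * y) ⁻¹   ≈⟨ inverseʳ _ xy≉0 ⟩
    1#                     ≈⟨ inverseʳ y y≉0 ⟨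
    y * y ⁻¹               ∎)

  1⁻¹≈1 : 1# ⁻¹ ≈ 1#
  1⁻¹≈1 = trans (sym (*-identityˡ _)) (inverseʳ 1# (0≉1 ∘ sym))

  four : Carrier
  four = two * two

  two≉0 : ¬ (two ≈ 0#)
  two≉0 = fromℕ≉0 2 ∘ trans (solve 0 (# 1 :+ (# 1 :+ # 0) := # 2) refl)

  four≉0 : ¬ (four ≈ 0#)
  four≉0 = fromℕ≉0 4 ∘ trans (solve 0 (# 1 :+ (# 1 :+ (# 1 :+ (# 1 :+ # 0))) := # 2 :* # 2) refl)

module SumsAndProducts {c ℓ} (R : RealField c ℓ) where
  open RealField R
  open Series R using (sumBelow; prodBelow)
  open Relation.Binary.Reasoning.Setoid setoid
  open import Algebra.Properties.CommutativeSemigroup +-commutativeSemigroup using (interchange)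

  sumBelow-cong : ∀ n {f g : ℕ → Carrier} → (∀ {i} → i ℕ.< n → f i ≈ g i) →
                  sumBelow n f ≈ sumBelow n g
  sumBelow-cong zero f≈g = refl
  sumBelow-cong (suc n) f≈g = +-cong (sumBelow-cong n (f≈g ∘ ℕ.m<n⇒m<1+n)) (f≈g (ℕ.n<1+n n))

  sumBelow-+ : ∀ n (f g : ℕ → Carrier) →
               sumBelow n (λ i → f i + g i) ≈ sumBelow n f + sumBelow n g
  sumBelow-+ zero f g = sym (+-identityˡ 0#)
  sumBelow-+ (suc n) f g = trans (+-congʳ (sumBelow-+ n f g)) (interchange _ _ _ _)

  *-distribˡ-sumBelow : ∀ n a (f : ℕ → Carrier) → a * sumBelow n f ≈ sumBelow n (λ i → a * f i)
  *-distribˡ-sumBelow zero a f = zeroʳ a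
  *-distribˡ-sumBelow (suc n) a f = trans (distribˡ _ _ _) (+-congʳ (*-distribˡ-sumBelow n a f))

  sumBelow-suc : ∀ n (f : ℕ → Carrier) → sumBelow (suc n) f ≈ f 0 + sumBelow n (f ∘ suc)
  sumBelow-suc zero f = trans (+-identityˡ _) (sym (+-identityʳ _))
  sumBelow-suc (suc n) f = trans (+-congʳ (sumBelow-suc n f)) (+-assoc _ _ _)

  sumBelow-reverse : ∀ n (f : ℕ → Carrier) → sumBelow n f ≈ sumBelow n (λ i → f (n ℕ.∸ suc i))
  sumBelow-reverse zero f = refl
  sumBelow-reverse (suc n) f = begin
    sumBelow n f + f n                          ≈⟨ +-comm _ _ ⟩
    f n + sumBelow n f                          ≈⟨ +-congˡ (sumBelow-reverse n f) ⟩
    f n + sumBelow n (λ i → f (n ℕ.∸ suc i))    ≈⟨ sumBelow-suc n (λ i → f (n ℕ.∸ i)) ⟨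
    sumBelow (suc n) (λ i → f (n ℕ.∸ i))        ∎

  prodBelow-cong : ∀ n {f g : ℕ → Carrier} → (∀ i → f i ≈ g i) → prodBelow n f ≈ prodBelow n g
  prodBelow-cong zero f≈g = refl
  prodBelow-cong (suc n) f≈g = *-cong (prodBelow-cong n f≈g) (f≈g n)

  prodBelow-suc : ∀ n (f : ℕ → Carrier) → prodBelow (suc n) f ≈ f 0 * prodBelow n (f ∘ suc)
  prodBelow-suc zero f = trans (*-identityˡ _) (sym (*-identityʳ _))
  prodBelow-suc (suc n) f = trans (*-congʳ (prodBelow-suc n f)) (*-assoc _ _ _)

module PowerSeriesAlgebra {c ℓ} (R : RealField c ℓ) where
  open RealField R
  -- Defs declares no fixities for these operators.
  open Series R public
    renaming (_≋_ to infix 4 _≋_; _⊛_ to infixl 7 _⊛_; _⊖_ to infixl 6 _⊖_)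
  open RealFieldProperties R using (four; fromℕ-+; fromℕ-cancelˡ)
  open SumsAndProducts R
  open IntegerCoefficients commRing
  open Relation.Binary.Reasoning.Setoid setoid
  open import Algebra.Properties.CommutativeSemigroup *-commutativeSemigroup using (x∙yz≈y∙xz)

  infixl 6 _⊕_
  infixr 7 _·_
  infixr 8 X*_ [4+X²]*_

  _⊕_ : PowerSeries → PowerSeries → PowerSeries
  (f ⊕ g) n = f n + g n

  _·_ : Carrier → PowerSeries → PowerSeries
  (a · f) n = a * f n

  X*_ : PowerSeries → PowerSeries
  (X* f) zero = 0#
  (X* f) (suc n) = f n

  [4+X²]*_ : PowerSeries → PowerSeries
  [4+X²]* f = four · f ⊕ X* X* f

  θ : PowerSeries → PowerSeries
  θ f n = fromℕ n * f n

  ≋-setoid : Setoid c ℓ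
  ≋-setoid = record
    { Carrier = PowerSeries
    ; _≈_ = _≋_
    ; isEquivalence = record
      { refl = λ n → refl
      ; sym = λ f≋g n → sym (f≋g n)
      ; trans = λ f≋g g≋h n → trans (f≋g n) (g≋h n)
      }
    }

  open Setoid ≋-setoid public using () renaming (refl to ≋-refl; trans to ≋-trans)

  module ≋-Reasoning = Relation.Binary.Reasoning.Setoid ≋-setoid

  ⊕-cong : ∀ {f f' g g'} → f ≋ f' → g ≋ g' → f ⊕ g ≋ f' ⊕ g'
  ⊕-cong f≋f' g≋g' n = +-cong (f≋f' n) (g≋g' n)

  ·-congˡ : ∀ a {f g} → f ≋ g → a · f ≋ a · g
  ·-congˡ a f≋g n = *-congˡ (f≋g n)

  X*-cong : ∀ {f g} → f ≋ g → X* f ≋ X* g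
  X*-cong f≋g zero = refl
  X*-cong f≋g (suc n) = f≋g n

  [4+X²]*-cong : ∀ {f g} → f ≋ g → [4+X²]* f ≋ [4+X²]* g
  [4+X²]*-cong f≋g = ⊕-cong (·-congˡ four f≋g) (X*-cong (X*-cong f≋g))

  ⊛-cong : ∀ {f f' g g'} → f ≋ f' → g ≋ g' → f ⊛ g ≋ f' ⊛ g'
  ⊛-cong f≋f' g≋g' n = sumBelow-cong (suc n) (λ {i} _ → *-cong (f≋f' i) (g≋g' (n ℕ.∸ i)))

  ·-distribˡ-⊕ : ∀ a f g → a · (f ⊕ g) ≋ a · f ⊕ a · g
  ·-distribˡ-⊕ a f g n = distribˡ a (f n) (g n)

  X*-· : ∀ a f → X* (a · f) ≋ a · X* f
  X*-· a f zero = sym (zeroʳ a)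
  X*-· a f (suc n) = refl

  X*-⊕ : ∀ f g → X* (f ⊕ g) ≋ X* f ⊕ X* g
  X*-⊕ f g zero = sym (+-identityˡ 0#)
  X*-⊕ f g (suc n) = refl

  [4+X²]*-· : ∀ a f → [4+X²]* (a · f) ≋ a · [4+X²]* f
  [4+X²]*-· a f n = begin
    four * (a * f n) + (X* X* (a · f)) n   ≈⟨ +-congˡ (≋-trans (X*-cong (X*-· a f)) (X*-· a (X* f)) n) ⟩
    four * (a * f n) + a * (X* X* f) n     ≈⟨ solve 4 (λ q a x y → q :* (a :* x) :+ a :* y := a :* (q :* x :+ y))
                                                      refl four a (f n) _ ⟩
    a * ([4+X²]* f) n                       ∎

  [4+X²]*-⊕ : ∀ f g → [4+X²]* (f ⊕ g) ≋ [4+X²]* f ⊕ [4+X²]* g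
  [4+X²]*-⊕ f g n = begin
    four * (f n + g n) + (X* X* (f ⊕ g)) n            ≈⟨ +-congˡ (≋-trans (X*-cong (X*-⊕ f g)) (X*-⊕ (X* f) (X* g)) n) ⟩
    four * (f n + g n) + ((X* X* f) n + (X* X* g) n)  ≈⟨ solve 5 (λ q x y u v → q :* (x :+ y) :+ (u :+ v) := (q :* x :+ u) :+ (q :* y :+ v))
                                                                 refl four (f n) (g n) _ _ ⟩
    ([4+X²]* f ⊕ [4+X²]* g) n                          ∎

  [4+X²]*-X* : ∀ f → [4+X²]* X* f ≋ X* [4+X²]* f
  [4+X²]*-X* f zero = trans (+-identityʳ _) (zeroʳ four)
  [4+X²]*-X* f (suc n) = refl

  ⊛-comm : ∀ f g → f ⊛ g ≋ g ⊛ f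
  ⊛-comm f g n = begin
    sumBelow (suc n) (λ i → f i * g (n ℕ.∸ i))                    ≈⟨ sumBelow-reverse (suc n) _ ⟩
    sumBelow (suc n) (λ i → f (n ℕ.∸ i) * g (n ℕ.∸ (n ℕ.∸ i)))    ≈⟨ sumBelow-cong (suc n) reflect ⟩
    sumBelow (suc n) (λ i → g i * f (n ℕ.∸ i))                    ∎
    where
    reflect : ∀ {i} → i ℕ.< suc n → f (n ℕ.∸ i) * g (n ℕ.∸ (n ℕ.∸ i)) ≈ g i * f (n ℕ.∸ i)
    reflect i<1+n = trans (*-comm _ _) (*-congʳ (reflexive (≡.cong g (ℕ.m∸[m∸n]≡n (ℕ.s≤s⁻¹ i<1+n)))))

  ⊛-distribˡ-⊕ : ∀ f g h → f ⊛ (g ⊕ h) ≋ f ⊛ g ⊕ f ⊛ h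
  ⊛-distribˡ-⊕ f g h n = trans (sumBelow-cong (suc n) (λ _ → distribˡ _ _ _)) (sumBelow-+ (suc n) _ _)

  ⊛-·ʳ : ∀ f a g → f ⊛ (a · g) ≋ a · (f ⊛ g)
  ⊛-·ʳ f a g n = begin
    sumBelow (suc n) (λ i → f i * (a * g (n ℕ.∸ i)))   ≈⟨ sumBelow-cong (suc n) (λ _ → x∙yz≈y∙xz _ _ _) ⟩
    sumBelow (suc n) (λ i → a * (f i * g (n ℕ.∸ i)))   ≈⟨ *-distribˡ-sumBelow (suc n) a _ ⟨
    a * (f ⊛ g) n                                       ∎

  X*-⊛ : ∀ f g → X* f ⊛ g ≋ X* (f ⊛ g)
  X*-⊛ f g zero = trans (+-identityˡ _) (zeroˡ _)
  X*-⊛ f g (suc n) = begin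
    sumBelow (suc (suc n)) (λ i → (X* f) i * g (suc n ℕ.∸ i))   ≈⟨ sumBelow-suc (suc n) _ ⟩
    0# * g (suc n) + (f ⊛ g) n                                   ≈⟨ +-congʳ (zeroˡ _) ⟩
    0# + (f ⊛ g) n                                               ≈⟨ +-identityˡ _ ⟩
    (f ⊛ g) n                                                    ∎

  ⊛-X* : ∀ f g → f ⊛ X* g ≋ X* (f ⊛ g)
  ⊛-X* f g = ≋-trans (⊛-comm f (X* g)) (≋-trans (X*-⊛ g f) (X*-cong (⊛-comm g f)))

  ⊛-X*X* : ∀ f g → f ⊛ X* X* g ≋ X* X* (f ⊛ g)
  ⊛-X*X* f g = ≋-trans (⊛-X* f (X* g)) (X*-cong (⊛-X* f g))

  ⊛-[4+X²]* : ∀ f g → f ⊛ [4+X²]* g ≋ [4+X²]* (f ⊛ g)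
  ⊛-[4+X²]* f g = ≋-trans (⊛-distribˡ-⊕ f (four · g) (X* X* g)) (⊕-cong (⊛-·ʳ f four g) (⊛-X*X* f g))

  θ-⊛ : ∀ f g → θ (f ⊛ g) ≋ θ f ⊛ g ⊕ f ⊛ θ g
  θ-⊛ f g n = begin
    fromℕ n * (f ⊛ g) n                                                  ≈⟨ *-distribˡ-sumBelow (suc n) _ _ ⟩
    sumBelow (suc n) (λ i → fromℕ n * (f i * g (n ℕ.∸ i)))               ≈⟨ sumBelow-cong (suc n) (leibniz ∘ ℕ.s≤s⁻¹) ⟩
    sumBelow (suc n) (λ i → θ f i * g (n ℕ.∸ i) + f i * θ g (n ℕ.∸ i))   ≈⟨ sumBelow-+ (suc n) _ _ ⟩
    (θ f ⊛ g ⊕ f ⊛ θ g) n                                                ∎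
    where
    leibniz : ∀ {i} → i ℕ.≤ n → fromℕ n * (f i * g (n ℕ.∸ i)) ≈ θ f i * g (n ℕ.∸ i) + f i * θ g (n ℕ.∸ i)
    leibniz {i} i≤n = begin
      fromℕ n * (f i * g (n ℕ.∸ i))                       ≡⟨ ≡.cong (λ k → fromℕ k * (f i * g (n ℕ.∸ i))) (ℕ.m+[n∸m]≡n i≤n) ⟨
      fromℕ (i ℕ.+ (n ℕ.∸ i)) * (f i * g (n ℕ.∸ i))       ≈⟨ *-congʳ (fromℕ-+ i (n ℕ.∸ i)) ⟩
      (fromℕ i + fromℕ (n ℕ.∸ i)) * (f i * g (n ℕ.∸ i))   ≈⟨ solve 4 (λ a b x y → (a :+ b) :* (x :* y) := (a :* x) :* y :+ x :* (b :* y))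
                                                                    refl _ _ _ _ ⟩
      θ f i * g (n ℕ.∸ i) + f i * θ g (n ℕ.∸ i)           ∎

  θ-square : ∀ f → θ (f ⊛ f) ≋ two · (f ⊛ θ f)
  θ-square f n = trans (θ-⊛ f f n) (trans (+-congʳ (⊛-comm (θ f) f n)) (solve 1 (λ x → x :+ x := # 2 :* x) refl _))

  θ-[4+X²]* : ∀ f → θ ([4+X²]* f) ≋ [4+X²]* θ f ⊕ two · X* X* f
  θ-[4+X²]* f zero =
    solve 2 (λ q x → # 0 :* (q :* x :+ # 0) := (q :* (# 0 :* x) :+ # 0) :+ # 2 :* # 0) refl four (f 0)
  θ-[4+X²]* f (suc zero) =
    solve 2 (λ q x → (# 1 :+ # 0) :* (q :* x :+ # 0) := (q :* ((# 1 :+ # 0) :* x) :+ # 0) :+ # 2 :* # 0) refl four (f 1)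
  θ-[4+X²]* f (suc (suc n)) =
    solve 4 (λ q k x y → (# 1 :+ (# 1 :+ k)) :* (q :* x :+ y) := (q :* ((# 1 :+ (# 1 :+ k)) :* x) :+ k :* y) :+ # 2 :* y)
            refl four (fromℕ n) (f (suc (suc n))) (f n)

  θ-⊖-const : ∀ f a → θ (f ⊖ const a) ≋ θ f
  θ-⊖-const f a zero = trans (zeroˡ _) (sym (zeroˡ _))
  θ-⊖-const f a (suc n) = *-congˡ (solve 1 (λ x → x :- # 0 := x) refl (f (suc n)))

  θ-cancel : ∀ {f g} → f 0 ≈ g 0 → θ f ≋ θ g → f ≋ g
  θ-cancel f₀≈g₀ θf≋θg zero = f₀≈g₀
  θ-cancel f₀≈g₀ θf≋θg (suc n) = fromℕ-cancelˡ (suc n) (θf≋θg (suc n))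

module DifferentialSystem {c ℓ} (R : RealField c ℓ) where
  open RealField R
  open PowerSeriesAlgebra R
  open RealFieldProperties R using (four; four≉0; fromℕ-cancelˡ; *-cancelˡ)
  open Relation.Binary.Reasoning.Setoid setoid
  open import Algebra.Properties.Ring ring using (+-cancelʳ)

  record IsSolution (u : Carrier) (A B : PowerSeries) : Set ℓ where
    field
      A₀ : A 0 ≈ two
      B₀ : B 0 ≈ 0#
      θA : θ A ≋ u · X* B
      θB : [4+X²]* θ B ⊕ X* X* B ≋ u · X* A

  solution-unique : ∀ {u A B A' B'} → IsSolution u A B → IsSolution u A' B' → A ≋ A' × B ≋ B'
  solution-unique {u} {A} {B} {A'} {B'} S S' = proj₁ ∘ agree , proj₁ ∘ proj₂ ∘ agree
    where
    module S = IsSolution S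
    module S' = IsSolution S'

    X*θ-cong : ∀ n → (X* B) n ≈ (X* B') n → (X* θ B) n ≈ (X* θ B') n
    X*θ-cong zero _ = refl
    X*θ-cong (suc n) Bₙ≈B'ₙ = *-congˡ Bₙ≈B'ₙ

    -- At x^(n+1), θA fixes A (n+1) from B n, and θB fixes B (n+1) from A n and B (n-1).
    agree : ∀ n → A n ≈ A' n × B n ≈ B' n × (X* B) n ≈ (X* B') n
    agree zero = trans S.A₀ (sym S'.A₀) , trans S.B₀ (sym S'.B₀) , refl
    agree (suc n) with agree n
    ... | Aₙ , Bₙ , Bₙ₋₁ = A₁₊ₙ , B₁₊ₙ , Bₙ
      where
      A₁₊ₙ : A (suc n) ≈ A' (suc n)
      A₁₊ₙ = fromℕ-cancelˡ (suc n) (begin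
        fromℕ (suc n) * A (suc n)    ≈⟨ S.θA (suc n) ⟩
        u * B n                      ≈⟨ *-congˡ Bₙ ⟩
        u * B' n                     ≈⟨ S'.θA (suc n) ⟨
        fromℕ (suc n) * A' (suc n)   ∎)

      B₁₊ₙ : B (suc n) ≈ B' (suc n)
      B₁₊ₙ = fromℕ-cancelˡ (suc n) (*-cancelˡ four≉0 (+-cancelʳ _ _ _ (begin
        four * θ B (suc n) + ((X* θ B) n + (X* B) n)     ≈⟨ +-assoc _ _ _ ⟨
        ([4+X²]* θ B ⊕ X* X* B) (suc n)                  ≈⟨ S.θB (suc n) ⟩
        u * A n                                          ≈⟨ *-congˡ Aₙ ⟩
        u * A' n                                         ≈⟨ S'.θB (suc n) ⟨
        ([4+X²]* θ B' ⊕ X* X* B') (suc n)                ≈⟨ +-assoc _ _ _ ⟩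
        four * θ B' (suc n) + ((X* θ B') n + (X* B') n)  ≈⟨ +-congˡ (+-cong (X*θ-cong n Bₙ₋₁) Bₙ₋₁) ⟨
        four * θ B' (suc n) + ((X* θ B) n + (X* B) n)    ∎)))

module CoefficientIdentities {c ℓ} (R : RealField c ℓ) where
  open RealField R
  open PowerSeriesAlgebra R
  open RealFieldProperties R
  open SumsAndProducts R using (prodBelow-cong; prodBelow-suc)
  open DifferentialSystem R using (IsSolution)
  open IntegerCoefficients commRing
  open Relation.Binary.Reasoning.Setoid setoid
  open import Algebra.Properties.CommutativeSemigroup *-commutativeSemigroup using (x∙yz≈y∙xz)

  binom-congˡ : ∀ {x y} m → x ≈ y → binom x m ≈ binom y m
  binom-congˡ m x≈y = *-congʳ (prodBelow-cong m (λ _ → +-congʳ x≈y))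

  binom-1 : ∀ x → binom x 1 ≈ x
  binom-1 x = begin
    (1# * (x - 0#)) * (1# + 0#) ⁻¹   ≈⟨ *-cong (solve 1 (λ x → # 1 :* (x :- # 0) := x) refl x) (⁻¹-cong (+-identityʳ 1#)) ⟩
    x * 1# ⁻¹                        ≈⟨ *-congˡ 1⁻¹≈1 ⟩
    x * 1#                           ≈⟨ *-identityʳ x ⟩
    x                                ∎

  binom-suc-suc : ∀ x m → (fromℕ (2 ℕ.+ m) * fromℕ (1 ℕ.+ m)) * binom (x + 1#) (2 ℕ.+ m)
                          ≈ ((x + 1#) * (x - fromℕ m)) * binom x m
  binom-suc-suc x m = begin
    (c₂ * c₁) * (prodBelow (2 ℕ.+ m) g * F₂ ⁻¹)                ≈⟨ *-congˡ (*-congʳ (prodBelow-suc (suc m) g)) ⟩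
    (c₂ * c₁) * ((g 0 * prodBelow (suc m) (g ∘ suc)) * F₂ ⁻¹)   ≈⟨ *-congˡ (*-congʳ (*-congˡ (*-congʳ (prodBelow-cong m g-suc)))) ⟩
    (c₂ * c₁) * ((g 0 * (P * g (suc m))) * F₂ ⁻¹)               ≈⟨ solve 6 (λ c₂ c₁ a p b i → (c₂ :* c₁) :* ((a :* (p :* b)) :* i)
                                                                                              := (a :* b) :* (p :* ((c₂ :* c₁) :* i)))
                                                                         refl c₂ c₁ (g 0) P (g (suc m)) (F₂ ⁻¹) ⟩
    (g 0 * g (suc m)) * (P * ((c₂ * c₁) * F₂ ⁻¹))               ≈⟨ *-cong g₀g₁₊ₘ (*-congˡ c₂c₁F₂⁻¹≈F⁻¹) ⟩
    ((x + 1#) * (x - fromℕ m)) * (P * F ⁻¹)                     ∎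
    where
    c₁ c₂ F F₂ P : Carrier
    c₁ = fromℕ (1 ℕ.+ m)
    c₂ = fromℕ (2 ℕ.+ m)
    F = fromℕ (m ℕ.!)
    F₂ = fromℕ ((2 ℕ.+ m) ℕ.!)
    P = prodBelow m (λ i → x - fromℕ i)

    g : ℕ → Carrier
    g i = (x + 1#) - fromℕ i

    g-suc : ∀ i → g (suc i) ≈ x - fromℕ i
    g-suc i = solve 2 (λ x k → (x :+ # 1) :- (# 1 :+ k) := x :- k) refl x (fromℕ i)

    g₀g₁₊ₘ : g 0 * g (suc m) ≈ (x + 1#) * (x - fromℕ m)
    g₀g₁₊ₘ = solve 2 (λ x k → ((x :+ # 1) :- # 0) :* ((x :+ # 1) :- (# 1 :+ k)) := (x :+ # 1) :* (x :- k)) refl x (fromℕ m)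

    F₂≈c₂c₁F : F₂ ≈ (c₂ * c₁) * F
    F₂≈c₂c₁F = begin
      F₂                                 ≈⟨ fromℕ-* (2 ℕ.+ m) ((1 ℕ.+ m) ℕ.* m ℕ.!) ⟩
      c₂ * fromℕ ((1 ℕ.+ m) ℕ.* m ℕ.!)   ≈⟨ *-congˡ (fromℕ-* (1 ℕ.+ m) (m ℕ.!)) ⟩
      c₂ * (c₁ * F)                      ≈⟨ *-assoc _ _ _ ⟨
      (c₂ * c₁) * F                      ∎

    c₂c₁F₂⁻¹≈F⁻¹ : (c₂ * c₁) * F₂ ⁻¹ ≈ F ⁻¹
    c₂c₁F₂⁻¹≈F⁻¹ = trans (*-congˡ (⁻¹-cong F₂≈c₂c₁F)) (x*[x*y]⁻¹≈y⁻¹ (!≉0 m) (!≉0 (2 ℕ.+ m) ∘ trans F₂≈c₂c₁F))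
      where
      !≉0 : ∀ n → ¬ (fromℕ (n ℕ.!) ≈ 0#)
      !≉0 n = fromℕ≉0 (n ℕ.!) {{n ℕ.!≢0}}

  fromℕ-2* : ∀ j → fromℕ (2 ℕ.* j) ≈ two * fromℕ j
  fromℕ-2* j = trans (fromℕ-* 2 j) (*-congʳ (solve 0 (# 1 :+ (# 1 :+ # 0) := # 2) refl))

  twice-half : ∀ s → two * half s ≈ s
  twice-half s = x*[y*x⁻¹]≈y s two≉0

  parity-2* : ∀ j → parity (2 ℕ.* j) ≡ inj₁ j
  parity-2* zero = ≡.refl
  parity-2* (suc j) = ≡.subst (λ n → parity n ≡ inj₁ (suc j)) (≡.sym (ℕ.*-suc 2 j)) parity-2+2j
    where
    parity-2+2j : parity (2 ℕ.+ 2 ℕ.* j) ≡ inj₁ (suc j)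
    parity-2+2j rewrite parity-2* j = ≡.refl

  data Parity : ℕ → Set where
    even : ∀ j → Parity (2 ℕ.* j)
    odd  : ∀ j → Parity (1 ℕ.+ 2 ℕ.* j)

  parityView : ∀ n → Parity n
  parityView zero = even 0
  parityView (suc n) with parityView n
  ... | even j = odd j
  ... | odd j = ≡.subst Parity (ℕ.*-suc 2 j) (even (suc j))

  φ : Carrier → ℕ → Carrier
  φ s j = binom (half s + fromℕ j) (2 ℕ.* j ℕ.+ 1)

  Φ₀-2j : ∀ s j → Φ₀ s (2 ℕ.* j) ≈ 0#
  Φ₀-2j s j rewrite parity-2* j = refl

  Φ₀-1+2j : ∀ s j → Φ₀ s (1 ℕ.+ 2 ℕ.* j) ≈ φ s j
  Φ₀-1+2j s j rewrite parity-2* j = refl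

  Λ₀-1+2j : ∀ s j → Λ₀ s (1 ℕ.+ 2 ℕ.* j) ≈ 0#
  Λ₀-1+2j s j rewrite parity-2* j = refl

  θΛ₀-2+2j : ∀ s j → θ (Λ₀ s) (2 ℕ.+ 2 ℕ.* j) ≈ s * φ s j
  θΛ₀-2+2j s j rewrite parity-2* j = begin
    d * ((s * fromℕ (2 ℕ.* suc j) ⁻¹) * φ s j)   ≡⟨ ≡.cong (λ k → d * ((s * fromℕ k ⁻¹) * φ s j)) (ℕ.*-suc 2 j) ⟩
    d * ((s * d ⁻¹) * φ s j)                      ≈⟨ *-assoc _ _ _ ⟨
    (d * (s * d ⁻¹)) * φ s j                      ≈⟨ *-congʳ (x*[y*x⁻¹]≈y s (fromℕ≉0 (2 ℕ.+ 2 ℕ.* j))) ⟩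
    s * φ s j                                     ∎
    where
    d : Carrier
    d = fromℕ (2 ℕ.+ 2 ℕ.* j)

  φ-suc : ∀ s j → (fromℕ (3 ℕ.+ 2 ℕ.* j) * fromℕ (2 ℕ.+ 2 ℕ.* j)) * φ s (suc j)
                  ≈ (half s * half s - fromℕ (suc j) * fromℕ (suc j)) * φ s j
  φ-suc s j = begin
    (fromℕ (3 ℕ.+ 2 ℕ.* j) * fromℕ (2 ℕ.+ 2 ℕ.* j)) * φ s (suc j)
      ≡⟨ ≡.cong₂ (λ k l → (fromℕ (2 ℕ.+ k) * fromℕ (1 ℕ.+ k)) * binom (h + fromℕ (suc j)) l)
                 (≡.sym (ℕ.+-comm (2 ℕ.* j) 1)) (≡.cong (ℕ._+ 1) (ℕ.*-suc 2 j)) ⟩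
    (fromℕ (2 ℕ.+ m) * fromℕ (1 ℕ.+ m)) * binom (h + (1# + J)) (2 ℕ.+ m)
      ≈⟨ *-congˡ (binom-congˡ (2 ℕ.+ m) (solve 2 (λ h J → h :+ (# 1 :+ J) := (h :+ J) :+ # 1) refl h J)) ⟩
    (fromℕ (2 ℕ.+ m) * fromℕ (1 ℕ.+ m)) * binom ((h + J) + 1#) (2 ℕ.+ m)
      ≈⟨ binom-suc-suc (h + J) m ⟩
    ((h + J + 1#) * (h + J - fromℕ m)) * φ s j
      ≈⟨ *-congʳ (*-congˡ (+-congˡ (-‿cong (trans (fromℕ-+ (2 ℕ.* j) 1) (+-cong (fromℕ-2* j) (+-identityʳ 1#)))))) ⟩
    ((h + J + 1#) * (h + J - (two * J + 1#))) * φ s j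
      ≈⟨ *-congʳ (solve 2 (λ h J → (h :+ J :+ # 1) :* (h :+ J :- (# 2 :* J :+ # 1)) := h :* h :- (# 1 :+ J) :* (# 1 :+ J))
                          refl h J) ⟩
    (h * h - (1# + J) * (1# + J)) * φ s j
      ∎
    where
    h J : Carrier
    h = half s
    J = fromℕ j
    m : ℕ
    m = 2 ℕ.* j ℕ.+ 1

  θΛ₀ : ∀ s → θ (Λ₀ s) ≋ s · X* Φ₀ s
  θΛ₀ s zero = trans (zeroˡ _) (sym (zeroʳ s))
  θΛ₀ s (suc n) with parityView n
  ... | even j = trans (*-congˡ (Λ₀-1+2j s j)) (trans (zeroʳ _) (sym (trans (*-congˡ (Φ₀-2j s j)) (zeroʳ s))))
  ... | odd j = trans (θΛ₀-2+2j s j) (*-congˡ (sym (Φ₀-1+2j s j)))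

  Φ₀-equation-3+2j : ∀ s j → ([4+X²]* θ (Φ₀ s) ⊕ X* X* Φ₀ s) (3 ℕ.+ 2 ℕ.* j) ≈ s * Λ₀ s (2 ℕ.+ 2 ℕ.* j)
  Φ₀-equation-3+2j s j = fromℕ-cancelˡ (2 ℕ.+ 2 ℕ.* j) (begin
    d * ((four * (c₃ * Φ₀ s (3 ℕ.+ 2 ℕ.* j)) + (1# + E) * Φ₀ s (1 ℕ.+ 2 ℕ.* j)) + Φ₀ s (1 ℕ.+ 2 ℕ.* j))
      ≈⟨ *-congˡ (+-cong (+-cong (*-congˡ (*-congˡ Φ₀-3+2j)) (*-congˡ (Φ₀-1+2j s j))) (Φ₀-1+2j s j)) ⟩
    d * ((four * (c₃ * φ₁) + (1# + E) * φ₀) + φ₀)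
      ≈⟨ solve 4 (λ q e φ₁ φ₀ → let d = # 1 :+ (# 1 :+ e) in
                   d :* ((q :* ((# 1 :+ d) :* φ₁) :+ (# 1 :+ e) :* φ₀) :+ φ₀) := q :* (((# 1 :+ d) :* d) :* φ₁) :+ d :* (d :* φ₀))
                 refl four E φ₁ φ₀ ⟩
    four * ((c₃ * d) * φ₁) + d * (d * φ₀)
      ≈⟨ +-cong (*-congˡ (φ-suc s j)) (*-cong d≈ (*-congʳ d≈)) ⟩
    four * ((h * h - (1# + J) * (1# + J)) * φ₀) + (1# + (1# + two * J)) * ((1# + (1# + two * J)) * φ₀)
      ≈⟨ solve 3 (λ h J φ₀ → let d = # 1 :+ (# 1 :+ # 2 :* J) in
                   # 2 :* # 2 :* ((h :* h :- (# 1 :+ J) :* (# 1 :+ J)) :* φ₀) :+ d :* (d :* φ₀) := (# 2 :* h) :* ((# 2 :* h) :* φ₀))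
                 refl h J φ₀ ⟩
    (two * h) * ((two * h) * φ₀)
      ≈⟨ *-cong (twice-half s) (*-congʳ (twice-half s)) ⟩
    s * (s * φ₀)
      ≈⟨ *-congˡ (θΛ₀-2+2j s j) ⟨
    s * (d * Λ₀ s (2 ℕ.+ 2 ℕ.* j))
      ≈⟨ x∙yz≈y∙xz s d _ ⟩
    d * (s * Λ₀ s (2 ℕ.+ 2 ℕ.* j))
      ∎)
    where
    h J E d c₃ φ₀ φ₁ : Carrier
    h = half s
    J = fromℕ j
    E = fromℕ (2 ℕ.* j)
    d = fromℕ (2 ℕ.+ 2 ℕ.* j)
    c₃ = fromℕ (3 ℕ.+ 2 ℕ.* j)
    φ₀ = φ s j
    φ₁ = φ s (suc j)

    d≈ : d ≈ 1# + (1# + two * J)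
    d≈ = +-congˡ (+-congˡ (fromℕ-2* j))

    Φ₀-3+2j : Φ₀ s (3 ℕ.+ 2 ℕ.* j) ≈ φ₁
    Φ₀-3+2j = trans (reflexive (≡.cong (Φ₀ s ∘ suc) (≡.sym (ℕ.*-suc 2 j)))) (Φ₀-1+2j s (suc j))

  Φ₀-equation : ∀ s → [4+X²]* θ (Φ₀ s) ⊕ X* X* Φ₀ s ≋ s · X* Λ₀ s
  Φ₀-equation s zero = solve 3 (λ q s φ → (q :* (# 0 :* φ) :+ # 0) :+ # 0 := s :* # 0) refl four s (Φ₀ s 0)
  Φ₀-equation s (suc zero) = begin
    (four * (fromℕ 1 * binom (half s + 0#) 1) + 0#) + 0#   ≈⟨ +-congʳ (+-congʳ (*-congˡ (*-congˡ (binom-1 _)))) ⟩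
    (four * (fromℕ 1 * (half s + 0#)) + 0#) + 0#           ≈⟨ solve 1 (λ h → (# 2 :* # 2 :* ((# 1 :+ # 0) :* (h :+ # 0)) :+ # 0) :+ # 0
                                                                            := # 2 :* h :* # 2) refl (half s) ⟩
    two * half s * two                                     ≈⟨ *-congʳ (twice-half s) ⟩
    s * two                                                ∎
  Φ₀-equation s (suc (suc k)) with parityView k
  ... | odd j = Φ₀-equation-3+2j s j
  ... | even j = begin
    (four * (fromℕ (2 ℕ.+ 2 ℕ.* j) * Φ₀ s (2 ℕ.+ 2 ℕ.* j)) + fromℕ (2 ℕ.* j) * Φ₀ s (2 ℕ.* j)) + Φ₀ s (2 ℕ.* j)
      ≈⟨ +-cong (+-cong (*-congˡ (*-congˡ Φ₀-2+2j)) (*-congˡ (Φ₀-2j s j))) (Φ₀-2j s j) ⟩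
    (four * (fromℕ (2 ℕ.+ 2 ℕ.* j) * 0#) + fromℕ (2 ℕ.* j) * 0#) + 0#
      ≈⟨ solve 4 (λ q d e s → (q :* (d :* # 0) :+ e :* # 0) :+ # 0 := s :* # 0) refl four _ _ s ⟩
    s * 0#
      ≈⟨ *-congˡ (Λ₀-1+2j s j) ⟨
    s * Λ₀ s (1 ℕ.+ 2 ℕ.* j)
      ∎
    where
    Φ₀-2+2j : Φ₀ s (2 ℕ.+ 2 ℕ.* j) ≈ 0#
    Φ₀-2+2j = trans (reflexive (≡.cong (Φ₀ s) (≡.sym (ℕ.*-suc 2 j)))) (Φ₀-2j s (suc j))

  Λ₀Φ₀-isSolution : ∀ s → IsSolution s (Λ₀ s) (Φ₀ s)
  Λ₀Φ₀-isSolution s = record { A₀ = refl ; B₀ = refl ; θA = θΛ₀ s ; θB = Φ₀-equation s }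

module Doubling {c ℓ} (R : RealField c ℓ) (t : RealField.Carrier R) where
  open RealField R
  open PowerSeriesAlgebra R
  open RealFieldProperties R using (four)
  open DifferentialSystem R using (IsSolution)
  open CoefficientIdentities R using (θΛ₀; Φ₀-equation)
  open IntegerCoefficients commRing
  open ≋-Reasoning

  Λ Φ : PowerSeries
  Λ = Λ₀ t
  Φ = Φ₀ t

  two·[t·f]≋[t+t]·f : ∀ f → two · t · f ≋ (t + t) · f
  two·[t·f]≋[t+t]·f f n = solve 2 (λ t x → # 2 :* (t :* x) := (t :+ t) :* x) refl t (f n)

  ⊛-θΛ : ∀ f → f ⊛ θ Λ ≋ t · X* (f ⊛ Φ)
  ⊛-θΛ f = begin
    f ⊛ θ Λ          ≈⟨ ⊛-cong ≋-refl (θΛ₀ t) ⟩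
    f ⊛ (t · X* Φ)   ≈⟨ ⊛-·ʳ f t (X* Φ) ⟩
    t · (f ⊛ X* Φ)   ≈⟨ ·-congˡ t (⊛-X* f Φ) ⟩
    t · X* (f ⊛ Φ)   ∎

  ⊛-Φ-equation : ∀ f → [4+X²]* (f ⊛ θ Φ) ⊕ X* X* (f ⊛ Φ) ≋ t · X* (f ⊛ Λ)
  ⊛-Φ-equation f = begin
    [4+X²]* (f ⊛ θ Φ) ⊕ X* X* (f ⊛ Φ)   ≈⟨ ⊕-cong (⊛-[4+X²]* f (θ Φ)) (⊛-X*X* f Φ) ⟨
    f ⊛ [4+X²]* θ Φ ⊕ f ⊛ X* X* Φ       ≈⟨ ⊛-distribˡ-⊕ f ([4+X²]* θ Φ) (X* X* Φ) ⟨
    f ⊛ ([4+X²]* θ Φ ⊕ X* X* Φ)         ≈⟨ ⊛-cong ≋-refl (Φ₀-equation t) ⟩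
    f ⊛ (t · X* Λ)                      ≈⟨ ⊛-·ʳ f t (X* Λ) ⟩
    t · (f ⊛ X* Λ)                      ≈⟨ ·-congˡ t (⊛-X* f Λ) ⟩
    t · X* (f ⊛ Λ)                      ∎

  θ[Λ⊛Λ] : θ (Λ ⊛ Λ) ≋ (t + t) · X* (Φ ⊛ Λ)
  θ[Λ⊛Λ] = begin
    θ (Λ ⊛ Λ)              ≈⟨ θ-square Λ ⟩
    two · (Λ ⊛ θ Λ)        ≈⟨ ·-congˡ two (⊛-θΛ Λ) ⟩
    two · t · X* (Λ ⊛ Φ)   ≈⟨ two·[t·f]≋[t+t]·f _ ⟩
    (t + t) · X* (Λ ⊛ Φ)   ≈⟨ ·-congˡ (t + t) (X*-cong (⊛-comm Λ Φ)) ⟩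
    (t + t) · X* (Φ ⊛ Λ)   ∎

  -- A Pell-type equation Λ² − (4 + x²) Φ² = 4, i.e. cosh² − sinh² = 1.
  pell-identity : [4+X²]* (Φ ⊛ Φ) ≋ Λ ⊛ Λ ⊖ const four
  pell-identity = θ-cancel (solve 0 (# 2 :* # 2 :* (# 0 :+ # 0 :* # 0) :+ # 0 := (# 0 :+ # 2 :* # 2) :- # 2 :* # 2) refl) (begin
    θ ([4+X²]* (Φ ⊛ Φ))                                ≈⟨ θ-[4+X²]* (Φ ⊛ Φ) ⟩
    [4+X²]* θ (Φ ⊛ Φ) ⊕ two · X* X* (Φ ⊛ Φ)            ≈⟨ ⊕-cong ([4+X²]*-cong (θ-square Φ)) ≋-refl ⟩
    [4+X²]* (two · (Φ ⊛ θ Φ)) ⊕ two · X* X* (Φ ⊛ Φ)    ≈⟨ ⊕-cong ([4+X²]*-· two (Φ ⊛ θ Φ)) ≋-refl ⟩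
    two · [4+X²]* (Φ ⊛ θ Φ) ⊕ two · X* X* (Φ ⊛ Φ)      ≈⟨ ·-distribˡ-⊕ two _ _ ⟨
    two · ([4+X²]* (Φ ⊛ θ Φ) ⊕ X* X* (Φ ⊛ Φ))          ≈⟨ ·-congˡ two (⊛-Φ-equation Φ) ⟩
    two · t · X* (Φ ⊛ Λ)                               ≈⟨ two·[t·f]≋[t+t]·f _ ⟩
    (t + t) · X* (Φ ⊛ Λ)                               ≈⟨ θ[Λ⊛Λ] ⟨
    θ (Λ ⊛ Λ)                                          ≈⟨ θ-⊖-const (Λ ⊛ Λ) four ⟨
    θ (Λ ⊛ Λ ⊖ const four)                             ∎)

  t·X*f⊕t·X*[f⊖4]≋[t+t]·X*[f⊖2] : ∀ f → t · X* f ⊕ t · X* (f ⊖ const four) ≋ (t + t) · X* (f ⊖ const two)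
  t·X*f⊕t·X*[f⊖4]≋[t+t]·X*[f⊖2] f zero =
    solve 1 (λ t → t :* # 0 :+ t :* # 0 := (t :+ t) :* # 0) refl t
  t·X*f⊕t·X*[f⊖4]≋[t+t]·X*[f⊖2] f (suc zero) =
    solve 2 (λ t x → t :* x :+ t :* (x :- # 2 :* # 2) := (t :+ t) :* (x :- # 2)) refl t (f 0)
  t·X*f⊕t·X*[f⊖4]≋[t+t]·X*[f⊖2] f (suc (suc n)) =
    solve 2 (λ t x → t :* x :+ t :* (x :- # 0) := (t :+ t) :* (x :- # 0)) refl t (f (suc n))

  doubled-isSolution : IsSolution (t + t) (Λ ⊛ Λ ⊖ const two) (Φ ⊛ Λ)
  doubled-isSolution = record
    { A₀ = solve 0 ((# 0 :+ # 2 :* # 2) :- # 2 := # 2) refl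
    ; B₀ = solve 0 (# 0 :+ # 0 :* # 2 := # 0) refl
    ; θA = ≋-trans (θ-⊖-const (Λ ⊛ Λ) two) θ[Λ⊛Λ]
    ; θB = begin
        [4+X²]* θ (Φ ⊛ Λ) ⊕ X* X* (Φ ⊛ Λ)
          ≈⟨ ⊕-cong (≋-trans ([4+X²]*-cong (θ-⊛ Φ Λ)) ([4+X²]*-⊕ (θ Φ ⊛ Λ) (Φ ⊛ θ Λ))) ≋-refl ⟩
        [4+X²]* (θ Φ ⊛ Λ) ⊕ [4+X²]* (Φ ⊛ θ Λ) ⊕ X* X* (Φ ⊛ Λ)
          ≈⟨ (λ n → xy∙z≈xz∙y _ _ _) ⟩
        [4+X²]* (θ Φ ⊛ Λ) ⊕ X* X* (Φ ⊛ Λ) ⊕ [4+X²]* (Φ ⊛ θ Λ)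
          ≈⟨ ⊕-cong (⊕-cong ([4+X²]*-cong (⊛-comm (θ Φ) Λ)) (X*-cong (X*-cong (⊛-comm Φ Λ)))) ([4+X²]*-cong (⊛-θΛ Φ)) ⟩
        [4+X²]* (Λ ⊛ θ Φ) ⊕ X* X* (Λ ⊛ Φ) ⊕ [4+X²]* (t · X* (Φ ⊛ Φ))
          ≈⟨ ⊕-cong (⊛-Φ-equation Λ) ([4+X²]*-· t (X* (Φ ⊛ Φ))) ⟩
        t · X* (Λ ⊛ Λ) ⊕ t · [4+X²]* X* (Φ ⊛ Φ)
          ≈⟨ ⊕-cong ≋-refl (·-congˡ t (≋-trans ([4+X²]*-X* (Φ ⊛ Φ)) (X*-cong pell-identity))) ⟩
        t · X* (Λ ⊛ Λ) ⊕ t · X* (Λ ⊛ Λ ⊖ const four)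
          ≈⟨ t·X*f⊕t·X*[f⊖4]≋[t+t]·X*[f⊖2] (Λ ⊛ Λ) ⟩
        (t + t) · X* (Λ ⊛ Λ ⊖ const two)
          ∎
    }
    where open import Algebra.Properties.CommutativeSemigroup +-commutativeSemigroup using (xy∙z≈xz∙y)

mainTheorem10 : ∀ {c ℓ : Level} (R : RealField c ℓ) →
    let open RealField R
        open Series R
    in ∀ (t : Carrier) →
         (Φ₀ (t + t) ≋ (Φ₀ t ⊛ Λ₀ t)) × (Λ₀ (t + t) ≋ ((Λ₀ t ⊛ Λ₀ t) ⊖ const two))
mainTheorem10 R t = swap (solution-unique (Λ₀Φ₀-isSolution (t + t)) doubled-isSolution)
  where
  open RealField R using (_+_)
  open DifferentialSystem R using (solution-unique)
  open CoefficientIdentities R using (Λ₀Φ₀-isSolution)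
  open Doubling R t using (doubled-isSolution)
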